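{- Let $(\mathcal{C},\mathcal{L})$ be a strict indexed symmetric monoidal category with a comprehension schema $(\mathbf{p},\mathbf{v})$. Let $\mathcal{I}$ be the full sub-indexed category of $\mathcal{C}/-$ (indexed via a choice of pullbacks) on the objects of the form $\mathbf{p}_{\Delta,A}$. Then the assignments $$M_\Delta(A\xrightarrow{a}B):=\ \mathbf{p}_{\Delta,A}\xrightarrow{\ \langle \mathbf{p}_{\Delta,A},\ a\{\mathbf{p}_{\Delta,A}\}\circ\mathbf{v}_{\Delta,A}\rangle\ }\mathbf{p}_{\Delta,B}$$ define a morphism of indexed categories $M:\mathcal{L}\to\mathcal{I}$.
   Context: A strict indexed symmetric monoidal category is a functor $\mathcal{L}:\mathcal{C}^{op}\to\mathrm{SMCat}$ into the category of small symmetric monoidal categories and strong monoidal functors, where $\mathcal{C}$ is a category with terminal object; write $-\{f\}:=\mathcal{L}(f)$. A comprehension schema consists of, for each $\Delta\in\mathcal{C}$ and $A\in\mathcal{L}(\Delta)$, a representation of the functor $(\mathcal{C}/\Delta)^{op}\to\mathrm{Set}$, $x\mapsto\mathcal{L}(\mathrm{dom}\,x)(I,A\{x\})$: a representing object $\mathbf{p}_{\Delta,A}:\Delta.A\to\Delta$ of $\mathcal{C}/\Delta$ and universal element $\mathbf{v}_{\Delta,A}\in\mathcal{L}(\Delta.A)(I,A\{\mathbf{p}_{\Delta,A}\})$. For $f:\Delta'\to\Delta$ and $a\in\mathcal{L}(\Delta')(I,A\{f\})$, $\langle f,a\rangle\in\mathcal{C}/\Delta(f,\mathbf{p}_{\Delta,A})$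 denotes the morphism corresponding to $a$ under the induced bijection. -}

module Defs where

open import Data.Product using (Σ; _,_; proj₁; proj₂)
open import Relation.Binary.PropositionalEquality
  using (_≡_; refl; sym; trans; cong; cong₂; subst; subst₂)

-- All categories are small: objects and hom-sets live in
-- Set, and equality of morphisms is propositional equality (hom-sets are
-- sets).  Axiom K is available, so proofs of equations are irrelevant.

uip : ∀ {A : Set} {x y : A} (e e' : x ≡ y) → e ≡ e'
uip refl refl = refl

Σ-≡ : ∀ {A : Set} {B : A → Set} {a a' : A} {b : B a} {b' : B a'} →
      a ≡ a' → (∀ (x : B a') → (y : B a') → x ≡ y) → (a , b) ≡ (a' , b')
Σ-≡ {b = b} {b'} refl irr = cong (_ ,_) (irr b b')

record Category : Set₁ where
  infixr 9 _∘_
  field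
    Obj : Set
    Hom : Obj → Obj → Set
    id  : ∀ {A} → Hom A A
    _∘_ : ∀ {A B C} → Hom B C → Hom A B → Hom A C
    identityˡ : ∀ {A B} (f : Hom A B) → id ∘ f ≡ f
    identityʳ : ∀ {A B} (f : Hom A B) → f ∘ id ≡ f
    assoc : ∀ {A B C D} (h : Hom C D) (g : Hom B C) (f : Hom A B) →
            (h ∘ g) ∘ f ≡ h ∘ (g ∘ f)

record Iso (C : Category) (A B : Category.Obj C) : Set where
  open Category C
  field
    to   : Hom A B
    from : Hom B A
    isoˡ : from ∘ to ≡ id
    isoʳ : to ∘ from ≡ id

record SymmetricMonoidalCategory : Set₁ where
  field
    cat : Category
  open Category cat
  infixr 10 _⊗₀_ _⊗₁_
  field
    _⊗₀_ : Obj → Obj → Obj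
    _⊗₁_ : ∀ {A B C D} → Hom A B → Hom C D → Hom (A ⊗₀ C) (B ⊗₀ D)
    ⊗-id : ∀ {A B} → id {A} ⊗₁ id {B} ≡ id
    ⊗-∘  : ∀ {A B C A' B' C'} (f : Hom B C) (g : Hom A B) (h : Hom B' C') (k : Hom A' B') →
           (f ∘ g) ⊗₁ (h ∘ k) ≡ (f ⊗₁ h) ∘ (g ⊗₁ k)
    unit : Obj
    α : ∀ A B C → Iso cat ((A ⊗₀ B) ⊗₀ C) (A ⊗₀ (B ⊗₀ C))
    λ' : ∀ A → Iso cat (unit ⊗₀ A) A
    ρ : ∀ A → Iso cat (A ⊗₀ unit) A
    σ : ∀ A B → Hom (A ⊗₀ B) (B ⊗₀ A)
    α-nat : ∀ {A A' B B' C C'} (f : Hom A A') (g : Hom B B') (h : Hom C C') →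
            Iso.to (α A' B' C') ∘ ((f ⊗₁ g) ⊗₁ h) ≡ (f ⊗₁ (g ⊗₁ h)) ∘ Iso.to (α A B C)
    λ-nat : ∀ {A A'} (f : Hom A A') → Iso.to (λ' A') ∘ (id ⊗₁ f) ≡ f ∘ Iso.to (λ' A)
    ρ-nat : ∀ {A A'} (f : Hom A A') → Iso.to (ρ A') ∘ (f ⊗₁ id) ≡ f ∘ Iso.to (ρ A)
    σ-nat : ∀ {A A' B B'} (f : Hom A A') (g : Hom B B') →
            σ A' B' ∘ (f ⊗₁ g) ≡ (g ⊗₁ f) ∘ σ A B
    pentagon : ∀ A B C D →
      (id ⊗₁ Iso.to (α B C D)) ∘ Iso.to (α A (B ⊗₀ C) D) ∘ (Iso.to (α A B C) ⊗₁ id)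
        ≡ Iso.to (α A B (C ⊗₀ D)) ∘ Iso.to (α (A ⊗₀ B) C D)
    triangle : ∀ A B →
      (id ⊗₁ Iso.to (λ' B)) ∘ Iso.to (α A unit B) ≡ Iso.to (ρ A) ⊗₁ id
    σ-involutive : ∀ A B → σ B A ∘ σ A B ≡ id
    hexagon : ∀ A B C →
      Iso.to (α B C A) ∘ σ A (B ⊗₀ C) ∘ Iso.to (α A B C)
        ≡ (id ⊗₁ σ A C) ∘ Iso.to (α B A C) ∘ (σ A B ⊗₁ id)

module SMC (M : SymmetricMonoidalCategory) where
  open SymmetricMonoidalCategory M public
  open Category cat public

record StrongMonoidalFunctor (M N : SymmetricMonoidalCategory) : Set where
  private
    module M = SMC M
    module N = SMC N
  field
    F₀ : M.Obj → N.Obj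
    F₁ : ∀ {A B} → M.Hom A B → N.Hom (F₀ A) (F₀ B)
    F-id : ∀ {A} → F₁ (M.id {A}) ≡ N.id
    F-∘ : ∀ {A B C} (f : M.Hom B C) (g : M.Hom A B) → F₁ (f M.∘ g) ≡ F₁ f N.∘ F₁ g
    ε : Iso N.cat N.unit (F₀ M.unit)
    μ : ∀ A B → Iso N.cat (F₀ A N.⊗₀ F₀ B) (F₀ (A M.⊗₀ B))
    μ-nat : ∀ {A A' B B'} (f : M.Hom A A') (g : M.Hom B B') →
      Iso.to (μ A' B') N.∘ (F₁ f N.⊗₁ F₁ g) ≡ F₁ (f M.⊗₁ g) N.∘ Iso.to (μ A B)
    μ-assoc : ∀ A B C →
      F₁ (Iso.to (M.α A B C)) N.∘ Iso.to (μ (A M.⊗₀ B) C) N.∘ (Iso.to (μ A B) N.⊗₁ N.id)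
        ≡ Iso.to (μ A (B M.⊗₀ C)) N.∘ (N.id N.⊗₁ Iso.to (μ B C)) N.∘ Iso.to (N.α (F₀ A) (F₀ B) (F₀ C))
    μ-unitˡ : ∀ A →
      F₁ (Iso.to (M.λ' A)) N.∘ Iso.to (μ M.unit A) N.∘ (Iso.to ε N.⊗₁ N.id)
        ≡ Iso.to (N.λ' (F₀ A))
    μ-unitʳ : ∀ A →
      F₁ (Iso.to (M.ρ A)) N.∘ Iso.to (μ A M.unit) N.∘ (N.id N.⊗₁ Iso.to ε)
        ≡ Iso.to (N.ρ (F₀ A))

record IsIdentitySMF {M : SymmetricMonoidalCategory} (H : StrongMonoidalFunctor M M) : Set where
  private module M = SMC M
  open StrongMonoidalFunctor H
  field
    eq₀ : ∀ X → F₀ X ≡ X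
    eq₁ : ∀ {X Y} (f : M.Hom X Y) → subst₂ M.Hom (eq₀ X) (eq₀ Y) (F₁ f) ≡ f
    eqε : subst (M.Hom M.unit) (eq₀ M.unit) (Iso.to ε) ≡ M.id
    eqμ : ∀ X Y →
      subst₂ M.Hom (cong₂ M._⊗₀_ (eq₀ X) (eq₀ Y)) (eq₀ (X M.⊗₀ Y)) (Iso.to (μ X Y)) ≡ M.id

record IsCompositeSMF {A B C : SymmetricMonoidalCategory}
  (F : StrongMonoidalFunctor A B) (G : StrongMonoidalFunctor B C)
  (H : StrongMonoidalFunctor A C) : Set where
  private
    module A = SMC A
    module C = SMC C
    module F = StrongMonoidalFunctor F
    module G = StrongMonoidalFunctor G
    module H = StrongMonoidalFunctor H
  field
    eq₀ : ∀ X → H.F₀ X ≡ G.F₀ (F.F₀ X)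
    eq₁ : ∀ {X Y} (f : A.Hom X Y) →
      subst₂ C.Hom (eq₀ X) (eq₀ Y) (H.F₁ f) ≡ G.F₁ (F.F₁ f)
    eqε : subst (C.Hom C.unit) (eq₀ A.unit) (Iso.to H.ε)
            ≡ G.F₁ (Iso.to F.ε) C.∘ Iso.to G.ε
    eqμ : ∀ X Y →
      subst₂ C.Hom (cong₂ C._⊗₀_ (eq₀ X) (eq₀ Y)) (eq₀ (X A.⊗₀ Y)) (Iso.to (H.μ X Y))
        ≡ G.F₁ (Iso.to (F.μ X Y)) C.∘ Iso.to (G.μ (F.F₀ X) (F.F₀ Y))

record StrictIndexedSMC : Set₁ where
  field
    C : Category
  open Category C
  field
    ⊤ : Obj
    ! : ∀ Γ → Hom Γ ⊤
    !-unique : ∀ {Γ} (h : Hom Γ ⊤) → h ≡ ! Γ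
    L : Obj → SymmetricMonoidalCategory
    reindex : ∀ {Δ' Δ} → Hom Δ' Δ → StrongMonoidalFunctor (L Δ) (L Δ')
    reindex-id : ∀ Δ → IsIdentitySMF (reindex (id {Δ}))
    reindex-∘ : ∀ {Δ'' Δ' Δ} (f : Hom Δ' Δ) (g : Hom Δ'' Δ') →
      IsCompositeSMF (reindex f) (reindex g) (reindex (f ∘ g))

module Indexed (𝓛 : StrictIndexedSMC) where
  open StrictIndexedSMC 𝓛 public
  open Category C public

  Fib : Obj → Category
  Fib Δ = SymmetricMonoidalCategory.cat (L Δ)

  FObj : Obj → Set
  FObj Δ = Category.Obj (Fib Δ)

  FHom : (Δ : Obj) → FObj Δ → FObj Δ → Set
  FHom Δ = Category.Hom (Fib Δ)

  𝐈 : (Δ : Obj) → FObj Δ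
  𝐈 Δ = SymmetricMonoidalCategory.unit (L Δ)

  _⟦_⟧ : ∀ {Δ' Δ} → FObj Δ → Hom Δ' Δ → FObj Δ'
  A ⟦ f ⟧ = StrongMonoidalFunctor.F₀ (reindex f) A

  _⟦_⟧₁ : ∀ {Δ' Δ} {A B : FObj Δ} → FHom Δ A B → (f : Hom Δ' Δ) → FHom Δ' (A ⟦ f ⟧) (B ⟦ f ⟧)
  a ⟦ f ⟧₁ = StrongMonoidalFunctor.F₁ (reindex f) a

  -- Action of the functor  (C/Δ)^op → Set,  x ↦ L(dom x)(I, A{x})
  -- on a morphism h : y → x of C/Δ (so y = x ∘ h):
  --   a ↦ a{h} ∘ φ₀  (transported along A{x}{h} = A{x ∘ h} = A{y}).
  act : ∀ {Δ Γ Γ'} (A : FObj Δ) (x : Hom Γ Δ) (h : Hom Γ' Γ) (y : Hom Γ' Δ) →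
        x ∘ h ≡ y → FHom Γ (𝐈 Γ) (A ⟦ x ⟧) → FHom Γ' (𝐈 Γ') (A ⟦ y ⟧)
  act {Γ' = Γ'} A x h y e a =
    subst (FHom Γ' (𝐈 Γ'))
      (trans (sym (IsCompositeSMF.eq₀ (reindex-∘ x h) A)) (cong (λ z → A ⟦ z ⟧) e))
      (Category._∘_ (Fib Γ') (a ⟦ h ⟧₁) (Iso.to (StrongMonoidalFunctor.ε (reindex h))))

-- Comprehension schema: for each Δ and A ∈ L(Δ) a representation
-- (p_{Δ,A}, v_{Δ,A}) of  x ↦ L(dom x)(I, A{x}).

record Comprehension (𝓛 : StrictIndexedSMC) : Set where
  open Indexed 𝓛
  field
    ext : ∀ Δ → FObj Δ → Obj
    p : ∀ {Δ} (A : FObj Δ) → Hom (ext Δ A) Δ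
    v : ∀ {Δ} (A : FObj Δ) → FHom (ext Δ A) (𝐈 (ext Δ A)) (A ⟦ p A ⟧)
    -- universality: h ↦ act(h)(v) is a bijection C/Δ(x, p_{Δ,A}) ≅ L(dom x)(I, A{x})
    univ : ∀ {Δ} (A : FObj Δ) {Γ} (x : Hom Γ Δ) (a : FHom Γ (𝐈 Γ) (A ⟦ x ⟧)) →
      Σ (Hom Γ (ext Δ A)) (λ h → Σ (p A ∘ h ≡ x) (λ e → act A (p A) h x e (v A) ≡ a))
    univ-unique : ∀ {Δ} (A : FObj Δ) {Γ} (x : Hom Γ Δ) (a : FHom Γ (𝐈 Γ) (A ⟦ x ⟧))
      (h : Hom Γ (ext Δ A)) (e : p A ∘ h ≡ x) → act A (p A) h x e (v A) ≡ a →
      h ≡ proj₁ (univ A x a)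

module Compr (𝓛 : StrictIndexedSMC) (𝓟 : Comprehension 𝓛) where
  open Indexed 𝓛 public
  open Comprehension 𝓟 public

  ⟨_,_⟩ : ∀ {Δ Γ} {A : FObj Δ} (f : Hom Γ Δ) (a : FHom Γ (𝐈 Γ) (A ⟦ f ⟧)) →
          Σ (Hom Γ (ext Δ A)) (λ h → p A ∘ h ≡ f)
  ⟨_,_⟩ {A = A} f a = proj₁ (univ A f a) , proj₁ (proj₂ (univ A f a))

record PullbackChoice (𝓛 : StrictIndexedSMC) (𝓟 : Comprehension 𝓛) : Set where
  open Compr 𝓛 𝓟
  field
    pb : ∀ {Δ' Δ} (f : Hom Δ' Δ) (A : FObj Δ) → FObj Δ'
    q  : ∀ {Δ' Δ} (f : Hom Δ' Δ) (A : FObj Δ) → Hom (ext Δ' (pb f A)) (ext Δ A)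
    comm : ∀ {Δ' Δ} (f : Hom Δ' Δ) (A : FObj Δ) → p A ∘ q f A ≡ f ∘ p (pb f A)
    gap : ∀ {Δ' Δ} (f : Hom Δ' Δ) (A : FObj Δ) {Γ} (u : Hom Γ (ext Δ A)) (w : Hom Γ Δ') →
          p A ∘ u ≡ f ∘ w → Hom Γ (ext Δ' (pb f A))
    gap-q : ∀ {Δ' Δ} (f : Hom Δ' Δ) (A : FObj Δ) {Γ} (u : Hom Γ (ext Δ A)) (w : Hom Γ Δ')
            (e : p A ∘ u ≡ f ∘ w) → q f A ∘ gap f A u w e ≡ u
    gap-p : ∀ {Δ' Δ} (f : Hom Δ' Δ) (A : FObj Δ) {Γ} (u : Hom Γ (ext Δ A)) (w : Hom Γ Δ')
            (e : p A ∘ u ≡ f ∘ w) → p (pb f A) ∘ gap f A u w e ≡ w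
    gap-unique : ∀ {Δ' Δ} (f : Hom Δ' Δ) (A : FObj Δ) {Γ} (u : Hom Γ (ext Δ A)) (w : Hom Γ Δ')
            (e : p A ∘ u ≡ f ∘ w) (k : Hom Γ (ext Δ' (pb f A))) →
            q f A ∘ k ≡ u → p (pb f A) ∘ k ≡ w → k ≡ gap f A u w e

-- Indexed categories (pseudofunctors C^op → Cat): the data needed to
-- speak of morphisms between them.

record IndexedCategory (C : Category) : Set₁ where
  open Category C
  field
    fib : Obj → Category
  private
    module F (Δ : Obj) = Category (fib Δ)
  field
    re₀ : ∀ {Δ' Δ} → Hom Δ' Δ → F.Obj Δ → F.Obj Δ'
    re₁ : ∀ {Δ' Δ} (f : Hom Δ' Δ) {A B : F.Obj Δ} → F.Hom Δ A B → F.Hom Δ' (re₀ f A) (re₀ f B)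
    unitor : ∀ Δ (A : F.Obj Δ) → F.Hom Δ A (re₀ id A)
    compositor : ∀ {Δ'' Δ' Δ} (f : Hom Δ' Δ) (g : Hom Δ'' Δ') (A : F.Obj Δ) →
                 F.Hom Δ'' (re₀ (f ∘ g) A) (re₀ g (re₀ f A))

record IsIndexedMorphism {C : Category} (P Q : IndexedCategory C)
  (M₀ : ∀ Δ → Category.Obj (IndexedCategory.fib P Δ) → Category.Obj (IndexedCategory.fib Q Δ))
  (M₁ : ∀ Δ {A B} → Category.Hom (IndexedCategory.fib P Δ) A B →
         Category.Hom (IndexedCategory.fib Q Δ) (M₀ Δ A) (M₀ Δ B)) : Set where
  open Category C
  private
    module P = IndexedCategory P
    module Q = IndexedCategory Q
    module PF (Δ : Obj) = Category (P.fib Δ)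
    module QF (Δ : Obj) = Category (Q.fib Δ)
  field
    M-id : ∀ Δ {A} → M₁ Δ (PF.id Δ {A}) ≡ QF.id Δ
    M-∘ : ∀ Δ {A B D} (a : PF.Hom Δ B D) (b : PF.Hom Δ A B) →
          M₁ Δ (PF._∘_ Δ a b) ≡ QF._∘_ Δ (M₁ Δ a) (M₁ Δ b)
    τ : ∀ {Δ' Δ} (f : Hom Δ' Δ) (A : PF.Obj Δ) →
        Iso (Q.fib Δ') (Q.re₀ f (M₀ Δ A)) (M₀ Δ' (P.re₀ f A))
    τ-nat : ∀ {Δ' Δ} (f : Hom Δ' Δ) {A B : PF.Obj Δ} (a : PF.Hom Δ A B) →
      QF._∘_ Δ' (Iso.to (τ f B)) (Q.re₁ f (M₁ Δ a))
        ≡ QF._∘_ Δ' (M₁ Δ' (P.re₁ f a)) (Iso.to (τ f A))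
    τ-unit : ∀ Δ (A : PF.Obj Δ) →
      QF._∘_ Δ (Iso.to (τ id A)) (Q.unitor Δ (M₀ Δ A)) ≡ M₁ Δ (P.unitor Δ A)
    τ-comp : ∀ {Δ'' Δ' Δ} (f : Hom Δ' Δ) (g : Hom Δ'' Δ') (A : PF.Obj Δ) →
      QF._∘_ Δ'' (Iso.to (τ g (P.re₀ f A)))
        (QF._∘_ Δ'' (Q.re₁ g (Iso.to (τ f A))) (Q.compositor f g (M₀ Δ A)))
        ≡ QF._∘_ Δ'' (M₁ Δ'' (P.compositor f g A)) (Iso.to (τ (f ∘ g) A))

underlying : (𝓛 : StrictIndexedSMC) → IndexedCategory (StrictIndexedSMC.C 𝓛)
underlying 𝓛 = record
  { fib = Fib
  ; re₀ = λ f A → A ⟦ f ⟧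
  ; re₁ = λ f a → a ⟦ f ⟧₁
  ; unitor = λ Δ A → subst (FHom Δ A) (sym (IsIdentitySMF.eq₀ (reindex-id Δ) A)) (Category.id (Fib Δ))
  ; compositor = λ {Δ''} f g A →
      subst (FHom Δ'' (A ⟦ f ∘ g ⟧)) (IsCompositeSMF.eq₀ (reindex-∘ f g) A) (Category.id (Fib Δ''))
  }
  where open Indexed 𝓛

-- The full sub-indexed category 𝓘 of C/- on the objects p_{Δ,A}
-- (objects of 𝓘(Δ) are named by A; morphisms are those of C/Δ),
-- reindexed along the given choice of pullbacks.

module SubIndexed (𝓛 : StrictIndexedSMC) (𝓟 : Comprehension 𝓛) (𝓑 : PullbackChoice 𝓛 𝓟) where
  open Compr 𝓛 𝓟
  open PullbackChoice 𝓑

  SHom : ∀ Δ → FObj Δ → FObj Δ → Set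
  SHom Δ A B = Σ (Hom (ext Δ A) (ext Δ B)) (λ h → p B ∘ h ≡ p A)

  SHom-≡ : ∀ {Δ A B} {h k : SHom Δ A B} → proj₁ h ≡ proj₁ k → h ≡ k
  SHom-≡ e = Σ-≡ e uip

  sfib : Obj → Category
  sfib Δ = record
    { Obj = FObj Δ
    ; Hom = SHom Δ
    ; id = id , identityʳ _
    ; _∘_ = λ { {A} {B} {D} (h , eh) (k , ek) →
                h ∘ k , trans (sym (assoc (p D) h k)) (trans (cong (_∘ k) eh) ek) }
    ; identityˡ = λ _ → SHom-≡ (identityˡ _)
    ; identityʳ = λ _ → SHom-≡ (identityʳ _)
    ; assoc = λ _ _ _ → SHom-≡ (assoc _ _ _)
    }

  sre₁ : ∀ {Δ' Δ} (f : Hom Δ' Δ) {A B : FObj Δ} → SHom Δ A B → SHom Δ' (pb f A) (pb f B)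
  sre₁ f {A} {B} (h , eh) =
    gap f B (h ∘ q f A) (p (pb f A)) e , gap-p f B (h ∘ q f A) (p (pb f A)) e
    where
    e : p B ∘ (h ∘ q f A) ≡ f ∘ p (pb f A)
    e = trans (sym (assoc (p B) h (q f A))) (trans (cong (_∘ q f A) eh) (comm f A))

  sunitor : ∀ Δ (A : FObj Δ) → SHom Δ A (pb id A)
  sunitor Δ A = gap id A id (p A) e , gap-p id A id (p A) e
    where
    e : p A ∘ id ≡ id ∘ p A
    e = trans (identityʳ (p A)) (sym (identityˡ (p A)))

  scompositor : ∀ {Δ'' Δ' Δ} (f : Hom Δ' Δ) (g : Hom Δ'' Δ') (A : FObj Δ) →
                SHom Δ'' (pb (f ∘ g) A) (pb g (pb f A))
  scompositor f g A =
    gap g (pb f A) k' (p (pb (f ∘ g) A)) e , gap-p g (pb f A) k' (p (pb (f ∘ g) A)) e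
    where
    e' : p A ∘ q (f ∘ g) A ≡ f ∘ (g ∘ p (pb (f ∘ g) A))
    e' = trans (comm (f ∘ g) A) (assoc f g (p (pb (f ∘ g) A)))
    k' : Hom (ext _ (pb (f ∘ g) A)) (ext _ (pb f A))
    k' = gap f A (q (f ∘ g) A) (g ∘ p (pb (f ∘ g) A)) e'
    e : p (pb f A) ∘ k' ≡ g ∘ p (pb (f ∘ g) A)
    e = gap-p f A (q (f ∘ g) A) (g ∘ p (pb (f ∘ g) A)) e'

  𝓘 : IndexedCategory C
  𝓘 = record
    { fib = sfib
    ; re₀ = pb
    ; re₁ = sre₁
    ; unitor = sunitor
    ; compositor = scompositor
    }

  M : ∀ Δ {A B : FObj Δ} → FHom Δ A B → SHom Δ A B
  M Δ {A} {B} a = ⟨_,_⟩ {A = B} (p A) (Category._∘_ (Fib (ext Δ A)) (a ⟦ p A ⟧₁) (v A))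

-- A morphism h : Γ → Δ.A is determined by p ∘ h and the element v{h} it
-- classifies, and M_Δ(a) is characterised by v_B{M a} = a{p_A} ∘ v_A.  Every
-- equation of the theorem is therefore checked by comparing projections and
-- classified elements, using only strictness of reindexing.  The comparison
-- cells τ_f arise because p_{Δ',A{f}} is, by comprehension, itself a pullback
-- of p_{Δ,A} along f, hence isomorphic to the chosen one.
module Submission where

open import Defs
open import Data.Product using (_,_; proj₁; proj₂)
open import Relation.Binary.PropositionalEquality
  using (_≡_; refl; sym; trans; cong; subst; subst₂)

-- Reindexing is strict only up to propositional equality of objects, so
-- morphisms with different (but provably equal) endpoints must be compared.
data Het {O : Set} (H : O → O → Set) {A B : O} (f : H A B) : {A' B' : O} → H A' B' → Set where
  hrefl : Het H f f

module _ {O : Set} {H : O → O → Set} where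

  het-sym : ∀ {A B A' B'} {f : H A B} {g : H A' B'} → Het H f g → Het H g f
  het-sym hrefl = hrefl

  het-trans : ∀ {A B A' B' A'' B''} {f : H A B} {g : H A' B'} {k : H A'' B''} →
              Het H f g → Het H g k → Het H f k
  het-trans hrefl q = q

  ≡⇒het : ∀ {A B} {f g : H A B} → f ≡ g → Het H f g
  ≡⇒het refl = hrefl

  het⇒≡ : ∀ {A B} {f g : H A B} → Het H f g → f ≡ g
  het⇒≡ hrefl = refl

  subst₂-het : ∀ {A B A' B'} (e₁ : A ≡ A') (e₂ : B ≡ B') (f : H A B) → Het H (subst₂ H e₁ e₂ f) f
  subst₂-het refl refl f = hrefl

  subst-het : ∀ {A B B'} (e : B ≡ B') (f : H A B) → Het H (subst (H A) e f) f
  subst-het refl f = hrefl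

module Het-Reasoning {O : Set} (H : O → O → Set) where

  infix  1 begin_
  infixr 2 _≋⟨_⟩_ _≋˘⟨_⟩_ _≡⟨_⟩_
  infix  3 _∎

  begin_ : ∀ {A B A' B'} {f : H A B} {g : H A' B'} → Het H f g → Het H f g
  begin q = q

  _≋⟨_⟩_ : ∀ {A B A' B' A'' B''} (f : H A B) {g : H A' B'} {k : H A'' B''} →
           Het H f g → Het H g k → Het H f k
  f ≋⟨ q ⟩ r = het-trans q r

  _≋˘⟨_⟩_ : ∀ {A B A' B' A'' B''} (f : H A B) {g : H A' B'} {k : H A'' B''} →
            Het H g f → Het H g k → Het H f k
  f ≋˘⟨ q ⟩ r = het-trans (het-sym q) r

  _≡⟨_⟩_ : ∀ {A B A'' B''} (f : H A B) {g : H A B} {k : H A'' B''} →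
           f ≡ g → Het H g k → Het H f k
  f ≡⟨ q ⟩ r = het-trans (≡⇒het q) r

  _∎ : ∀ {A B} (f : H A B) → Het H f f
  f ∎ = hrefl

het-cong : ∀ {O O' : Set} {H : O → O → Set} {H' : O' → O' → Set}
           (F₀ : O → O') (F₁ : ∀ {A B} → H A B → H' (F₀ A) (F₀ B))
           {A B A' B'} {f : H A B} {g : H A' B'} → Het H f g → Het H' (F₁ f) (F₁ g)
het-cong F₀ F₁ hrefl = hrefl

module _ (C : Category) where
  open Category C

  ∘-het : ∀ {A B D A' B' D'} {f : Hom B D} {f' : Hom B' D'} {g : Hom A B} {g' : Hom A' B'} →
          Het Hom f f' → Het Hom g g' → Het Hom (f ∘ g) (f' ∘ g')
  ∘-het hrefl hrefl = hrefl

  het-identityˡ : ∀ {A B D Z} {f : Hom B D} (g : Hom A B) → Het Hom f (id {Z}) → Het Hom (f ∘ g) g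
  het-identityˡ g hrefl = ≡⇒het (identityˡ g)

module Reindexing (𝓛 : StrictIndexedSMC) where
  open Indexed 𝓛

  infix 4 _≋_
  _≋_ : ∀ {Γ A B A' B'} → FHom Γ A B → FHom Γ A' B' → Set
  _≋_ {Γ} f g = Het (FHom Γ) f g

  infixr 9 _·_
  _·_ : ∀ {Γ X Y Z} → FHom Γ Y Z → FHom Γ X Y → FHom Γ X Z
  _·_ {Γ} = Category._∘_ (Fib Γ)

  ·-het : ∀ {Γ X Y Z X' Y' Z'} {a : FHom Γ Y Z} {a' : FHom Γ Y' Z'} {b : FHom Γ X Y} {b' : FHom Γ X' Y'} →
          a ≋ a' → b ≋ b' → a · b ≋ a' · b'
  ·-het = ∘-het (Fib _)

  ε : ∀ {Γ' Γ} (h : Hom Γ' Γ) → FHom Γ' (𝐈 Γ') (𝐈 Γ ⟦ h ⟧)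
  ε h = Iso.to (StrongMonoidalFunctor.ε (reindex h))

  ⟦⟧₁-id : ∀ {Γ X Y} (a : FHom Γ X Y) → a ⟦ id ⟧₁ ≋ a
  ⟦⟧₁-id {Γ} {X} {Y} a = het-trans (het-sym (subst₂-het (eq₀ X) (eq₀ Y) (a ⟦ id ⟧₁))) (≡⇒het (eq₁ a))
    where open IsIdentitySMF (reindex-id Γ)

  ε-id : ∀ {Γ} → ε (id {Γ}) ≋ Category.id (Fib Γ) {𝐈 Γ}
  ε-id {Γ} = het-trans (het-sym (subst-het (eq₀ (𝐈 Γ)) (ε id))) (≡⇒het eqε)
    where open IsIdentitySMF (reindex-id Γ)

  ⟦⟧₁-∘ : ∀ {Γ'' Γ' Γ X Y} (f : Hom Γ' Γ) (g : Hom Γ'' Γ') (a : FHom Γ X Y) →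
          a ⟦ f ∘ g ⟧₁ ≋ (a ⟦ f ⟧₁) ⟦ g ⟧₁
  ⟦⟧₁-∘ {X = X} {Y} f g a = het-trans (het-sym (subst₂-het (eq₀ X) (eq₀ Y) (a ⟦ f ∘ g ⟧₁))) (≡⇒het (eq₁ a))
    where open IsCompositeSMF (reindex-∘ f g)

  ε-∘ : ∀ {Γ'' Γ' Γ} (f : Hom Γ' Γ) (g : Hom Γ'' Γ') → ε (f ∘ g) ≋ (ε f ⟦ g ⟧₁) · ε g
  ε-∘ {Γ = Γ} f g = het-trans (het-sym (subst-het (eq₀ (𝐈 Γ)) (ε (f ∘ g)))) (≡⇒het eqε)
    where open IsCompositeSMF (reindex-∘ f g)

  ⟦⟧₁-het : ∀ {Γ' Γ X Y X' Y'} (h : Hom Γ' Γ) {a : FHom Γ X Y} {b : FHom Γ X' Y'} →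
            a ≋ b → a ⟦ h ⟧₁ ≋ b ⟦ h ⟧₁
  ⟦⟧₁-het h = het-cong (_⟦ h ⟧) (_⟦ h ⟧₁)

  ⟦⟧₁-path : ∀ {Γ' Γ X Y} {h h' : Hom Γ' Γ} (a : FHom Γ X Y) → h ≡ h' → a ⟦ h ⟧₁ ≋ a ⟦ h' ⟧₁
  ⟦⟧₁-path a refl = hrefl

  ⟦⟧₁-along : ∀ {Γ'' Γ' Γ X Y} {f : Hom Γ' Γ} {g : Hom Γ'' Γ'} {h : Hom Γ'' Γ} (a : FHom Γ X Y) →
              f ∘ g ≡ h → (a ⟦ f ⟧₁) ⟦ g ⟧₁ ≋ a ⟦ h ⟧₁
  ⟦⟧₁-along {f = f} {g} a e = het-trans (het-sym (⟦⟧₁-∘ f g a)) (⟦⟧₁-path a e)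

  ⟦⟧₁-het-id : ∀ {Γ' Γ X Y Z} (h : Hom Γ' Γ) {a : FHom Γ X Y} →
               a ≋ Category.id (Fib Γ) {Z} → a ⟦ h ⟧₁ ≋ Category.id (Fib Γ') {Z ⟦ h ⟧}
  ⟦⟧₁-het-id h hrefl = ≡⇒het (StrongMonoidalFunctor.F-id (reindex h))

  infix 10 _⟦_⟧ₑ
  _⟦_⟧ₑ : ∀ {Γ' Γ X} → FHom Γ (𝐈 Γ) X → (h : Hom Γ' Γ) → FHom Γ' (𝐈 Γ') (X ⟦ h ⟧)
  a ⟦ h ⟧ₑ = (a ⟦ h ⟧₁) · ε h

  act-het : ∀ {Δ Γ Γ'} (A : FObj Δ) (x : Hom Γ Δ) (h : Hom Γ' Γ) (y : Hom Γ' Δ) (e : x ∘ h ≡ y)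
            (a : FHom Γ (𝐈 Γ) (A ⟦ x ⟧)) → act A x h y e a ≋ a ⟦ h ⟧ₑ
  act-het A x h y e a = subst-het _ _

  ⟦⟧ₑ-id : ∀ {Γ X} (a : FHom Γ (𝐈 Γ) X) → a ⟦ id ⟧ₑ ≋ a
  ⟦⟧ₑ-id {Γ} a = het-trans (·-het (⟦⟧₁-id a) ε-id) (≡⇒het (Category.identityʳ (Fib Γ) a))

  ⟦⟧ₑ-∘ : ∀ {Γ'' Γ' Γ X} (a : FHom Γ (𝐈 Γ) X) (h : Hom Γ' Γ) (k : Hom Γ'' Γ') →
          a ⟦ h ∘ k ⟧ₑ ≋ (a ⟦ h ⟧ₑ) ⟦ k ⟧ₑ
  ⟦⟧ₑ-∘ {Γ''} a h k = begin
    (a ⟦ h ∘ k ⟧₁) · ε (h ∘ k)                 ≋⟨ ·-het (⟦⟧₁-∘ h k a) (ε-∘ h k) ⟩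
    ((a ⟦ h ⟧₁) ⟦ k ⟧₁) · ((ε h ⟦ k ⟧₁) · ε k)  ≡⟨ sym (Category.assoc (Fib Γ'') _ _ _) ⟩
    (((a ⟦ h ⟧₁) ⟦ k ⟧₁) · (ε h ⟦ k ⟧₁)) · ε k  ≡⟨ cong (_· ε k) (sym (StrongMonoidalFunctor.F-∘ (reindex k) _ _)) ⟩
    (a ⟦ h ⟧ₑ) ⟦ k ⟧ₑ                           ∎
    where open Het-Reasoning (FHom Γ'')

  ⟦⟧ₑ-· : ∀ {Γ' Γ X Y} (c : FHom Γ X Y) (a : FHom Γ (𝐈 Γ) X) (h : Hom Γ' Γ) →
          (c · a) ⟦ h ⟧ₑ ≡ (c ⟦ h ⟧₁) · (a ⟦ h ⟧ₑ)
  ⟦⟧ₑ-· {Γ'} c a h = trans (cong (_· ε h) (StrongMonoidalFunctor.F-∘ (reindex h) c a))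
                           (Category.assoc (Fib Γ') _ _ _)

  ⟦⟧ₑ-het : ∀ {Γ' Γ X Y} {a : FHom Γ (𝐈 Γ) X} {b : FHom Γ (𝐈 Γ) Y} (h : Hom Γ' Γ) →
            a ≋ b → a ⟦ h ⟧ₑ ≋ b ⟦ h ⟧ₑ
  ⟦⟧ₑ-het h q = ·-het (⟦⟧₁-het h q) hrefl

  ⟦⟧ₑ-path : ∀ {Γ' Γ X} (a : FHom Γ (𝐈 Γ) X) {h h' : Hom Γ' Γ} → h ≡ h' → a ⟦ h ⟧ₑ ≋ a ⟦ h' ⟧ₑ
  ⟦⟧ₑ-path a refl = hrefl

module ComprehensionExt (𝓛 : StrictIndexedSMC) (𝓟 : Comprehension 𝓛) where
  open Compr 𝓛 𝓟
  open Reindexing 𝓛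

  ⟨⟩-β : ∀ {Δ Γ} (A : FObj Δ) (x : Hom Γ Δ) (a : FHom Γ (𝐈 Γ) (A ⟦ x ⟧)) →
         v A ⟦ proj₁ (⟨_,_⟩ {A = A} x a) ⟧ₑ ≋ a
  ⟨⟩-β A x a = het-trans (het-sym (act-het A (p A) _ x _ (v A))) (≡⇒het (proj₂ (proj₂ (univ A x a))))

  comprehension-ext : ∀ {Δ Γ} (A : FObj Δ) {h h' : Hom Γ (ext Δ A)} →
                      p A ∘ h ≡ p A ∘ h' → v A ⟦ h ⟧ₑ ≋ v A ⟦ h' ⟧ₑ → h ≡ h'
  comprehension-ext A {h} {h'} e q =
    trans (univ-unique A (p A ∘ h) a h refl refl)
          (sym (univ-unique A (p A ∘ h) a h' (sym e) (het⇒≡ a'≋a)))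
    where
    a = act A (p A) h (p A ∘ h) refl (v A)
    a'≋a : act A (p A) h' (p A ∘ h) (sym e) (v A) ≋ a
    a'≋a = het-trans (act-het A (p A) h' _ (sym e) (v A))
             (het-trans (het-sym q) (het-sym (act-het A (p A) h _ refl (v A))))

module ComprehensionMorphism (𝓛 : StrictIndexedSMC) (𝓟 : Comprehension 𝓛) (𝓑 : PullbackChoice 𝓛 𝓟) where
  open Compr 𝓛 𝓟
  open PullbackChoice 𝓑
  open SubIndexed 𝓛 𝓟 𝓑
  open Reindexing 𝓛
  open ComprehensionExt 𝓛 𝓟

  SHom-ext : ∀ {Δ X Y} {h k : SHom Δ X Y} → v Y ⟦ proj₁ h ⟧ₑ ≋ v Y ⟦ proj₁ k ⟧ₑ → h ≡ k
  SHom-ext {Y = Y} {h , eh} {k , ek} q = SHom-≡ (comprehension-ext Y (trans eh (sym ek)) q)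

  pullback-ext : ∀ {Δ' Δ Γ} (f : Hom Δ' Δ) (A : FObj Δ) {k k' : Hom Γ (ext Δ' (pb f A))} →
                 q f A ∘ k ≡ q f A ∘ k' → p (pb f A) ∘ k ≡ p (pb f A) ∘ k' → k ≡ k'
  pullback-ext f A {k} {k'} e₁ e₂ =
    trans (gap-unique f A _ _ e k e₁ e₂) (sym (gap-unique f A _ _ e k' refl refl))
    where
    e : p A ∘ (q f A ∘ k') ≡ f ∘ (p (pb f A) ∘ k')
    e = trans (sym (assoc _ _ _)) (trans (cong (_∘ k') (comm f A)) (assoc _ _ _))

  _∘ˢ_ : ∀ {Δ X Y Z} → SHom Δ Y Z → SHom Δ X Y → SHom Δ X Z
  _∘ˢ_ {Δ} = Category._∘_ (sfib Δ)

  Mᶜ : ∀ {Δ} {A B : FObj Δ} → FHom Δ A B → Hom (ext Δ A) (ext Δ B)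
  Mᶜ a = proj₁ (M _ a)

  M-β : ∀ {Δ} {A B : FObj Δ} (a : FHom Δ A B) → v B ⟦ Mᶜ a ⟧ₑ ≋ (a ⟦ p A ⟧₁) · v A
  M-β {A = A} {B} a = ⟨⟩-β B (p A) _

  M-β-∘ : ∀ {Δ Γ} {A B : FObj Δ} (a : FHom Δ A B) (k : Hom Γ (ext Δ A)) →
          v B ⟦ Mᶜ a ∘ k ⟧ₑ ≋ ((a ⟦ p A ⟧₁) ⟦ k ⟧₁) · (v A ⟦ k ⟧ₑ)
  M-β-∘ {Γ = Γ} {A} {B} a k = begin
    v B ⟦ Mᶜ a ∘ k ⟧ₑ             ≋⟨ ⟦⟧ₑ-∘ (v B) (Mᶜ a) k ⟩
    (v B ⟦ Mᶜ a ⟧ₑ) ⟦ k ⟧ₑ        ≋⟨ ⟦⟧ₑ-het k (M-β a) ⟩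
    ((a ⟦ p A ⟧₁) · v A) ⟦ k ⟧ₑ   ≡⟨ ⟦⟧ₑ-· (a ⟦ p A ⟧₁) (v A) k ⟩
    ((a ⟦ p A ⟧₁) ⟦ k ⟧₁) · (v A ⟦ k ⟧ₑ) ∎
    where open Het-Reasoning (FHom Γ)

  M-id : ∀ Δ {A} → M Δ (Category.id (Fib Δ) {A}) ≡ Category.id (sfib Δ)
  M-id Δ {A} = SHom-ext (begin
    v A ⟦ Mᶜ (Category.id (Fib Δ)) ⟧ₑ                ≋⟨ M-β _ ⟩
    (Category.id (Fib Δ) ⟦ p A ⟧₁) · v A             ≋⟨ het-identityˡ (Fib _) (v A) (⟦⟧₁-het-id (p A) hrefl) ⟩
    v A                                              ≋˘⟨ ⟦⟧ₑ-id (v A) ⟩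
    v A ⟦ id ⟧ₑ                                      ∎)
    where open Het-Reasoning (FHom (ext Δ A))

  M-∘ : ∀ Δ {A B D} (a : FHom Δ B D) (b : FHom Δ A B) → M Δ (a · b) ≡ M Δ a ∘ˢ M Δ b
  M-∘ Δ {A} {B} {D} a b = SHom-ext (begin
    v D ⟦ Mᶜ (a · b) ⟧ₑ                         ≋⟨ M-β (a · b) ⟩
    ((a · b) ⟦ p A ⟧₁) · v A                     ≡⟨ cong (_· v A) (StrongMonoidalFunctor.F-∘ (reindex (p A)) a b) ⟩
    ((a ⟦ p A ⟧₁) · (b ⟦ p A ⟧₁)) · v A          ≡⟨ Category.assoc (Fib _) _ _ _ ⟩
    (a ⟦ p A ⟧₁) · ((b ⟦ p A ⟧₁) · v A)          ≋˘⟨ ·-het (⟦⟧₁-along a (proj₂ (M Δ b))) (M-β b) ⟩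
    ((a ⟦ p B ⟧₁) ⟦ Mᶜ b ⟧₁) · (v B ⟦ Mᶜ b ⟧ₑ)   ≋˘⟨ M-β-∘ a (Mᶜ b) ⟩
    v D ⟦ Mᶜ a ∘ Mᶜ b ⟧ₑ                         ∎)
    where open Het-Reasoning (FHom (ext Δ A))

  module Comparison {Δ' Δ} (f : Hom Δ' Δ) (A : FObj Δ) where
    private
      P = pb f A
      Af = A ⟦ f ⟧

      reindex-square : (A ⟦ p A ⟧) ⟦ q f A ⟧ ≡ Af ⟦ p P ⟧
      reindex-square = trans (sym (IsCompositeSMF.eq₀ (reindex-∘ (p A) (q f A)) A))
        (trans (cong (A ⟦_⟧) (comm f A)) (IsCompositeSMF.eq₀ (reindex-∘ f (p P)) A))

    to : SHom Δ' P Af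
    to = ⟨_,_⟩ {A = Af} (p P) (subst (FHom (ext Δ' P) (𝐈 (ext Δ' P))) reindex-square (v A ⟦ q f A ⟧ₑ))

    τᶜ : Hom (ext Δ' P) (ext Δ' Af)
    τᶜ = proj₁ to

    τ-β : v Af ⟦ τᶜ ⟧ₑ ≋ v A ⟦ q f A ⟧ₑ
    τ-β = het-trans (⟨⟩-β Af (p P) _) (subst-het reindex-square _)

    τ-β-∘ : ∀ {Γ} (k : Hom Γ (ext Δ' P)) → v Af ⟦ τᶜ ∘ k ⟧ₑ ≋ v A ⟦ q f A ∘ k ⟧ₑ
    τ-β-∘ {Γ} k = begin
      v Af ⟦ τᶜ ∘ k ⟧ₑ         ≋⟨ ⟦⟧ₑ-∘ (v Af) τᶜ k ⟩
      (v Af ⟦ τᶜ ⟧ₑ) ⟦ k ⟧ₑ    ≋⟨ ⟦⟧ₑ-het k τ-β ⟩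
      (v A ⟦ q f A ⟧ₑ) ⟦ k ⟧ₑ  ≋˘⟨ ⟦⟧ₑ-∘ (v A) (q f A) k ⟩
      v A ⟦ q f A ∘ k ⟧ₑ       ∎
      where open Het-Reasoning (FHom Γ)

    private
      u : Hom (ext Δ' Af) (ext Δ A)
      u = proj₁ (⟨_,_⟩ {A = A} (f ∘ p Af)
                  (subst (FHom (ext Δ' Af) (𝐈 (ext Δ' Af)))
                         (sym (IsCompositeSMF.eq₀ (reindex-∘ f (p Af)) A)) (v Af)))

      p∘u : p A ∘ u ≡ f ∘ p Af
      p∘u = proj₂ (⟨_,_⟩ {A = A} (f ∘ p Af) _)

      u-β : v A ⟦ u ⟧ₑ ≋ v Af
      u-β = het-trans (⟨⟩-β A (f ∘ p Af) _) (subst-het _ _)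

    from : SHom Δ' Af P
    from = gap f A u (p Af) p∘u , gap-p f A u (p Af) p∘u

    private
      q∘from : q f A ∘ proj₁ from ≡ u
      q∘from = gap-q f A u (p Af) p∘u

      u∘τ : u ∘ τᶜ ≡ q f A
      u∘τ = comprehension-ext A
        (trans (sym (assoc _ _ _)) (trans (cong (_∘ τᶜ) p∘u)
          (trans (assoc _ _ _) (trans (cong (f ∘_) (proj₂ to)) (sym (comm f A))))))
        (het-trans (⟦⟧ₑ-∘ (v A) u τᶜ) (het-trans (⟦⟧ₑ-het τᶜ u-β) τ-β))

      from∘to : from ∘ˢ to ≡ Category.id (sfib Δ')
      from∘to = SHom-≡ (pullback-ext f A
        (trans (sym (assoc _ _ _)) (trans (cong (_∘ τᶜ) q∘from) (trans u∘τ (sym (identityʳ _)))))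
        (trans (sym (assoc _ _ _)) (trans (cong (_∘ τᶜ) (proj₂ from)) (trans (proj₂ to) (sym (identityʳ _))))))

      to∘from : to ∘ˢ from ≡ Category.id (sfib Δ')
      to∘from = SHom-ext (begin
        v Af ⟦ τᶜ ∘ proj₁ from ⟧ₑ     ≋⟨ τ-β-∘ (proj₁ from) ⟩
        v A ⟦ q f A ∘ proj₁ from ⟧ₑ   ≋⟨ ⟦⟧ₑ-path (v A) q∘from ⟩
        v A ⟦ u ⟧ₑ                    ≋⟨ u-β ⟩
        v Af                          ≋˘⟨ ⟦⟧ₑ-id (v Af) ⟩
        v Af ⟦ id ⟧ₑ                  ∎)
        where open Het-Reasoning (FHom (ext Δ' Af))

    τ : Iso (sfib Δ') P Af
    τ = record { to = to ; from = from ; isoˡ = from∘to ; isoʳ = to∘from }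

  open Comparison using (τ; τᶜ; τ-β; τ-β-∘)

  private
    module 𝓛ᵘ = IndexedCategory (underlying 𝓛)

  τ-nat : ∀ {Δ' Δ} (f : Hom Δ' Δ) {A B : FObj Δ} (a : FHom Δ A B) →
          Iso.to (τ f B) ∘ˢ sre₁ f (M Δ a) ≡ M Δ' (a ⟦ f ⟧₁) ∘ˢ Iso.to (τ f A)
  τ-nat {Δ'} f {A} {B} a = SHom-ext (begin
    v (B ⟦ f ⟧) ⟦ τᶜ f B ∘ proj₁ (sre₁ f (M _ a)) ⟧ₑ       ≋⟨ τ-β-∘ f B _ ⟩
    v B ⟦ q f B ∘ proj₁ (sre₁ f (M _ a)) ⟧ₑ                ≋⟨ ⟦⟧ₑ-path (v B) (gap-q f B _ _ _) ⟩
    v B ⟦ Mᶜ a ∘ q f A ⟧ₑ                                  ≋⟨ M-β-∘ a (q f A) ⟩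
    ((a ⟦ p A ⟧₁) ⟦ q f A ⟧₁) · (v A ⟦ q f A ⟧ₑ)           ≋˘⟨ ·-het a-along-square (τ-β f A) ⟩
    (((a ⟦ f ⟧₁) ⟦ p Af ⟧₁) ⟦ τᶜ f A ⟧₁) · (v Af ⟦ τᶜ f A ⟧ₑ) ≋˘⟨ M-β-∘ (a ⟦ f ⟧₁) (τᶜ f A) ⟩
    v (B ⟦ f ⟧) ⟦ Mᶜ (a ⟦ f ⟧₁) ∘ τᶜ f A ⟧ₑ                ∎)
    where
    open Het-Reasoning (FHom (ext Δ' (pb f A)))
    Af = A ⟦ f ⟧
    a-along-square : ((a ⟦ f ⟧₁) ⟦ p Af ⟧₁) ⟦ τᶜ f A ⟧₁ ≋ (a ⟦ p A ⟧₁) ⟦ q f A ⟧₁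
    a-along-square = het-trans (⟦⟧₁-along (a ⟦ f ⟧₁) (proj₂ (Iso.to (τ f A))))
      (het-trans (het-sym (⟦⟧₁-∘ f (p (pb f A)) a)) (het-sym (⟦⟧₁-along a (comm f A))))

  τ-unit : ∀ Δ (A : FObj Δ) → Iso.to (τ id A) ∘ˢ sunitor Δ A ≡ M Δ (𝓛ᵘ.unitor Δ A)
  τ-unit Δ A = SHom-ext (begin
    v (A ⟦ id ⟧) ⟦ τᶜ id A ∘ proj₁ (sunitor Δ A) ⟧ₑ  ≋⟨ τ-β-∘ id A _ ⟩
    v A ⟦ q id A ∘ proj₁ (sunitor Δ A) ⟧ₑ            ≋⟨ ⟦⟧ₑ-path (v A) (gap-q id A _ _ _) ⟩
    v A ⟦ id ⟧ₑ                                      ≋⟨ ⟦⟧ₑ-id (v A) ⟩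
    v A                                              ≋˘⟨ het-identityˡ (Fib _) (v A) (⟦⟧₁-het-id (p A) (subst-het _ _)) ⟩
    (𝓛ᵘ.unitor Δ A ⟦ p A ⟧₁) · v A                   ≋˘⟨ M-β (𝓛ᵘ.unitor Δ A) ⟩
    v (A ⟦ id ⟧) ⟦ Mᶜ (𝓛ᵘ.unitor Δ A) ⟧ₑ             ∎)
    where open Het-Reasoning (FHom (ext Δ A))

  τ-comp : ∀ {Δ'' Δ' Δ} (f : Hom Δ' Δ) (g : Hom Δ'' Δ') (A : FObj Δ) →
           Iso.to (τ g (A ⟦ f ⟧)) ∘ˢ (sre₁ g (Iso.to (τ f A)) ∘ˢ scompositor f g A)
             ≡ M Δ'' (𝓛ᵘ.compositor f g A) ∘ˢ Iso.to (τ (f ∘ g) A)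
  τ-comp {Δ''} f g A = SHom-ext (begin
    v (Af ⟦ g ⟧) ⟦ τᶜ g Af ∘ (k₁ ∘ k₂) ⟧ₑ      ≋⟨ τ-β-∘ g Af (k₁ ∘ k₂) ⟩
    v Af ⟦ q g Af ∘ (k₁ ∘ k₂) ⟧ₑ               ≋⟨ ⟦⟧ₑ-path (v Af) q∘k₁k₂ ⟩
    v Af ⟦ τᶜ f A ∘ (q g (pb f A) ∘ k₂) ⟧ₑ     ≋⟨ τ-β-∘ f A (q g (pb f A) ∘ k₂) ⟩
    v A ⟦ q f A ∘ (q g (pb f A) ∘ k₂) ⟧ₑ       ≋⟨ ⟦⟧ₑ-path (v A) q∘q∘k₂ ⟩
    v A ⟦ q (f ∘ g) A ⟧ₑ                       ≋˘⟨ τ-β (f ∘ g) A ⟩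
    v Afg ⟦ τᶜ (f ∘ g) A ⟧ₑ                    ≋˘⟨ het-identityˡ (Fib _) _ (⟦⟧₁-het-id _ (⟦⟧₁-het-id _ (subst-het _ _))) ⟩
    ((c ⟦ p Afg ⟧₁) ⟦ τᶜ (f ∘ g) A ⟧₁) · (v Afg ⟦ τᶜ (f ∘ g) A ⟧ₑ)  ≋˘⟨ M-β-∘ c (τᶜ (f ∘ g) A) ⟩
    v (Af ⟦ g ⟧) ⟦ Mᶜ c ∘ τᶜ (f ∘ g) A ⟧ₑ     ∎)
    where
    open Het-Reasoning (FHom (ext Δ'' (pb (f ∘ g) A)))
    Af = A ⟦ f ⟧
    Afg = A ⟦ f ∘ g ⟧
    c = 𝓛ᵘ.compositor f g A
    k₁ = proj₁ (sre₁ g (Iso.to (τ f A)))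
    k₂ = proj₁ (scompositor f g A)
    q∘k₁k₂ : q g Af ∘ (k₁ ∘ k₂) ≡ τᶜ f A ∘ (q g (pb f A) ∘ k₂)
    q∘k₁k₂ = trans (sym (assoc _ _ _)) (trans (cong (_∘ k₂) (gap-q g Af _ _ _)) (assoc _ _ _))
    q∘q∘k₂ : q f A ∘ (q g (pb f A) ∘ k₂) ≡ q (f ∘ g) A
    q∘q∘k₂ = trans (cong (q f A ∘_) (gap-q g (pb f A) _ _ _)) (gap-q f A _ _ _)

  isIndexedMorphism : IsIndexedMorphism (underlying 𝓛) 𝓘 (λ Δ A → A) M
  isIndexedMorphism = record
    { M-id = M-id
    ; M-∘ = M-∘
    ; τ = τ
    ; τ-nat = τ-nat
    ; τ-unit = τ-unit
    ; τ-comp = τ-comp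
    }

theorem7 : (𝓛 : StrictIndexedSMC) (𝓟 : Comprehension 𝓛) (𝓑 : PullbackChoice 𝓛 𝓟) →
    IsIndexedMorphism (underlying 𝓛) (SubIndexed.𝓘 𝓛 𝓟 𝓑) (λ Δ A → A) (SubIndexed.M 𝓛 𝓟 𝓑)
theorem7 = ComprehensionMorphism.isIndexedMorphism
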